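{- Consider $L(b;x_1,y_1;x_2,y_2)$ with $b,x_1,x_2$ positive and $y_1,y_2$ nonnegative integers. Suppose that either (1) there is an odd integer $k$ with $x_2=kx_1$ and $y_2\equiv ky_1 \pmod{2b}$; or (2) there is an even integer $k$ with $x_2=kx_1$ and $y_2\equiv ky_1+b\pmod{2b}$. Then $L(b;x_1,y_1;x_2,y_2)$ has the same Sprague–Grundy values at every position as the vector game $L(b;x_1,y_1)$ defined by $\{(0,-b),(-x_1,y_1)\}$. In particular, $L(b;x_1,y_1;x_2,y_2)$ has no positions of value $2$ or $3$.
   Context: The vector game defined by a finite set $S\subseteq\mathbb{Z}^2$ is the impartial normal-play game on positions in $\mathbb{N}^2$ where a move consists of adding an element of $S$ to the current position, provided the result lies in $\mathbb{N}^2$. The Lengyel transfer game $L(b;x_1,y_1;x_2,y_2)$ is the vector game defined by $\{(0,-b),(-x_1,y_1),(-x_2,y_2)\}$. -}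

module Defs where

open import Data.Nat using (ℕ; _<_)
open import Data.Integer as ℤ using (ℤ; +_)
open import Data.Integer.Divisibility using (_∣_)
open import Data.Product using (Σ; _×_; _,_)
open import Data.List using (List; _∷_; [])
open import Data.List.Membership.Propositional using (_∈_)
open import Relation.Binary.PropositionalEquality using (_≡_; _≢_)

Pos : Set
Pos = ℕ × ℕ

VectorGame : Set
VectorGame = List (ℤ × ℤ)

-- q is an option (move) from p in the vector game S: q = p + s for some s ∈ S
-- (q ∈ ℕ² is automatic since q : Pos).
Option : VectorGame → Pos → Pos → Set
Option S (p₁ , p₂) (q₁ , q₂) =
  Σ (ℤ × ℤ) λ { (s₁ , s₂) → ((s₁ , s₂) ∈ S) × ((+ q₁ ≡ + p₁ ℤ.+ s₁) × (+ q₂ ≡ + p₂ ℤ.+ s₂)) }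

IsSG : VectorGame → (Pos → ℕ) → Set
IsSG S g = (p : Pos) →
  ((q : Pos) → Option S p q → g q ≢ g p) ×
  ((w : ℕ) → w < g p → Σ Pos λ q → Option S p q × (g q ≡ w))

L₁ : ℕ → ℕ → ℕ → VectorGame
L₁ b x₁ y₁ = (+ 0 , ℤ.- (+ b)) ∷ (ℤ.- (+ x₁) , + y₁) ∷ []

L₂ : ℕ → ℕ → ℕ → ℕ → ℕ → VectorGame
L₂ b x₁ y₁ x₂ y₂ = (+ 0 , ℤ.- (+ b)) ∷ (ℤ.- (+ x₁) , + y₁) ∷ (ℤ.- (+ x₂) , + y₂) ∷ []

OddZ : ℤ → Set
OddZ k = Σ ℤ λ j → k ≡ + 2 ℤ.* j ℤ.+ + 1

EvenZ : ℤ → Set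
EvenZ k = Σ ℤ λ j → k ≡ + 2 ℤ.* j

CongMod : ℤ → ℤ → ℤ → Set
CongMod m a c = m ∣ (a ℤ.- c)

-- Put a = ⌊p₁/x₁⌋ and len (p₁ , p₂) = a + ⌊(p₂ + a·y₁)/b⌋.  Every move of L(b;x₁,y₁) lowers
-- len by exactly one, and len vanishes on its terminal positions, so every play from p has
-- length len p and the Sprague–Grundy value of p is the parity of len p.  Under either
-- congruence the extra move (−x₂, y₂) is an integer combination of an odd number of basic
-- moves, so it changes len by an odd amount as well: the parity of len is still a
-- Sprague–Grundy function, and Sprague–Grundy functions are unique because every move
-- decreases the position lexicographically.
{-# OPTIONS --safe #-}
module Submission where

open import Defs
open import Data.Nat using (ℕ; _<_)
open import Data.Nat as ℕ using ()
open import Data.Integer as ℤ using (ℤ; +_)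
open import Data.Product using (Σ; _×_)
open import Data.Sum using (_⊎_)
open import Relation.Binary.PropositionalEquality using (_≡_; _≢_)

open import Data.Empty using (⊥-elim)
open import Data.Integer using (_⊖_; -[1+_])
open import Data.Integer.Properties
  using (+-injective; pos-+; pos-*; m-n≡m⊖n; ⊖-≥; ∣⊖∣-≤)
  renaming (+-identityʳ to ℤ-+-identityʳ)
import Data.Integer.Tactic.RingSolver as ℤ-Solver
open import Data.List.Relation.Binary.Subset.Propositional using (_⊆_)
open import Data.List.Relation.Unary.Any using (here; there)
open import Data.Nat
  using (zero; suc; _+_; _*_; _∸_; _≤_; _≤?_; z≤n; s≤s; NonZero; >-nonZero; parity)
open import Data.Nat.DivMod using (_/_; +-distrib-/-∣ʳ; m*n/n≡m; m<n⇒m/n≡0)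
open import Data.Nat.Divisibility using (divides)
open import Data.Nat.Induction using (<-wellFounded)
open import Data.Nat.Properties
  using (+-assoc; +-comm; +-identityʳ; *-identityˡ; ≤-antisym; ≤-total; ≮⇒≥; <⇒≱; ≰⇒>;
         m<m+n; m+[n∸m]≡n; +-commutativeSemigroup)
open import Algebra.Properties.CommutativeSemigroup +-commutativeSemigroup
  using () renaming (xy∙z≈xz∙y to +-right-comm)
import Data.Nat.Tactic.RingSolver as ℕ-Solver
open import Data.Parity.Base as ℙ using (Parity; 0ℙ; 1ℙ; _⁻¹)
open import Data.Parity.Properties as ℙ
  using (p≢p⁻¹; p+p≡0ℙ; ⁻¹-injective; +-homo-+; *-homo-*)
open import Data.Product using (_,_; proj₁; proj₂; map₂)
open import Data.Product.Relation.Binary.Lex.Strict using (×-Lex; ×-wellFounded)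
open import Data.Sum using (inj₁; inj₂)
open import Function using (_∘_)
open import Induction.WellFounded using (WellFounded; Acc; acc)
open import Level using (Level)
open import Relation.Binary.Core using (Rel)
open import Relation.Binary.PropositionalEquality
  using (refl; sym; trans; cong; subst; module ≡-Reasoning)
open import Relation.Nullary using (¬_; yes; no)

open ≡-Reasoning

private
  variable
    ℓ : Level
    S T : VectorGame
    p q : Pos
    b x₁ y₁ x₂ y₂ : ℕ

toℕ : Parity → ℕ
toℕ 0ℙ = 0
toℕ 1ℙ = 1

toℕ-injective : ∀ {u v} → toℕ u ≡ toℕ v → u ≡ v
toℕ-injective {0ℙ} {0ℙ} _ = refl
toℕ-injective {1ℙ} {1ℙ} _ = refl

toℕ≤1 : ∀ u → toℕ u ≤ 1
toℕ≤1 0ℙ = z≤n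
toℕ≤1 1ℙ = s≤s z≤n

parity-flip : ∀ {m c n d} → m + c ≡ n + d → parity (d + c) ≡ 1ℙ → parity m ≡ parity n ⁻¹
parity-flip {m} {c} {n} {d} m+c≡n+d d+c-odd = begin
  parity m                                ≡⟨ sym (ℙ.+-identityʳ _) ⟩
  parity m ℙ.+ 0ℙ                         ≡⟨ cong (parity m ℙ.+_) (sym (p+p≡0ℙ (parity c))) ⟩
  parity m ℙ.+ (parity c ℙ.+ parity c)    ≡⟨ sym (ℙ.+-assoc (parity m) _ _) ⟩
  parity m ℙ.+ parity c ℙ.+ parity c      ≡⟨ cong (ℙ._+ parity c) homo ⟩
  parity n ℙ.+ parity d ℙ.+ parity c      ≡⟨ ℙ.+-assoc (parity n) _ _ ⟩
  parity n ℙ.+ (parity d ℙ.+ parity c)    ≡⟨ cong (parity n ℙ.+_) d+c-odd′ ⟩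
  parity n ℙ.+ 1ℙ                         ≡⟨ ℙ.+-comm (parity n) 1ℙ ⟩
  parity n ⁻¹                             ∎
  where
  homo : parity m ℙ.+ parity c ≡ parity n ℙ.+ parity d
  homo = trans (sym (+-homo-+ m c)) (trans (cong parity m+c≡n+d) (+-homo-+ n d))
  d+c-odd′ : parity d ℙ.+ parity c ≡ 1ℙ
  d+c-odd′ = trans (sym (+-homo-+ d c)) d+c-odd

parity-+-2* : ∀ n m → parity (n + 2 * m) ≡ parity n
parity-+-2* n m =
  trans (+-homo-+ n (2 * m)) (trans (cong (parity n ℙ.+_) (*-homo-* 2 m)) (ℙ.+-identityʳ _))

Option-mono : S ⊆ T → Option S p q → Option T p q
Option-mono S⊆T ((s₁ , s₂) , s∈S , moved) = (s₁ , s₂) , S⊆T s∈S , moved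

isSG-≮ : ∀ {g h} → IsSG S g → IsSG S h → (∀ q → Option S p q → g q ≡ h q) → ¬ (g p < h p)
isSG-≮ {p = p} g-sg h-sg agree gp<hp with proj₂ (h-sg p) _ gp<hp
... | q , o , hq≡gp = proj₁ (g-sg p) q o (trans (agree q o) hq≡gp)

isSG-unique : ∀ {_≺_ : Rel Pos ℓ} {g h} → WellFounded _≺_ → (∀ {p q} → Option S p q → q ≺ p) →
              IsSG S g → IsSG S h → ∀ p → g p ≡ h p
isSG-unique {S = S} {_≺_ = _≺_} {g} {h} wf descends g-sg h-sg p = go p (wf p)
  where
  go : ∀ p → Acc _≺_ p → g p ≡ h p
  go p (acc rec) =
    ≤-antisym (≮⇒≥ (isSG-≮ h-sg g-sg (λ q o → sym (agree q o)))) (≮⇒≥ (isSG-≮ g-sg h-sg agree))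
    where
    agree : ∀ q → Option S p q → g q ≡ h q
    agree q o = go q (rec (descends o))

isSG-toℕ : (f : Pos → Parity) → (∀ {p q} → Option S p q → f p ≡ f q ⁻¹) →
           (∀ p → f p ≡ 1ℙ → Σ Pos (Option S p)) → IsSG S (toℕ ∘ f)
isSG-toℕ {S} f flips live p = differs , mex
  where
  differs : ∀ q → Option S p q → toℕ (f q) ≢ toℕ (f p)
  differs q o fq≡fp = p≢p⁻¹ (f q) (trans (toℕ-injective fq≡fp) (flips o))

  mex : ∀ w → w < toℕ (f p) → Σ Pos λ q → Option S p q × (toℕ (f q) ≡ w)
  mex w w<fp with f p in fp≡1ℙ
  mex (suc _) (s≤s ()) | 1ℙ
  mex zero _ | 1ℙ with live p fp≡1ℙ
  ... | q , o = q , o , cong toℕ (⁻¹-injective (trans (sym (flips o)) fp≡1ℙ))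

_<ₗₑₓ_ : Rel Pos _
_<ₗₑₓ_ = ×-Lex _≡_ _<_ _<_

<ₗₑₓ-wellFounded : WellFounded _<ₗₑₓ_
<ₗₑₓ-wellFounded = ×-wellFounded <-wellFounded <-wellFounded

data Move (b x₁ y₁ x₂ y₂ : ℕ) : Pos → Pos → Set where
  drop      : ∀ p₁ q₂ → Move b x₁ y₁ x₂ y₂ (p₁ , q₂ + b) (p₁ , q₂)
  transfer₁ : ∀ q₁ p₂ → Move b x₁ y₁ x₂ y₂ (q₁ + x₁ , p₂) (q₁ , p₂ + y₁)
  transfer₂ : ∀ q₁ p₂ → Move b x₁ y₁ x₂ y₂ (q₁ + x₂ , p₂) (q₁ , p₂ + y₂)

+m≡+n-+o⇒m+o≡n : ∀ {m n o} → + m ≡ + n ℤ.- + o → m + o ≡ n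
+m≡+n-+o⇒m+o≡n {m} {n} {o} eq = +-injective (begin
  + (m + o)             ≡⟨ pos-+ m o ⟩
  + m ℤ.+ + o           ≡⟨ cong (ℤ._+ + o) eq ⟩
  + n ℤ.- + o ℤ.+ + o   ≡⟨ [i-j]+j≡i (+ n) (+ o) ⟩
  + n                   ∎)
  where
  open ℤ-Solver using (solve-∀)
  [i-j]+j≡i : ∀ i j → i ℤ.- j ℤ.+ j ≡ i
  [i-j]+j≡i = solve-∀

+m≡+n++o⇒m≡n+o : ∀ {m n o} → + m ≡ + n ℤ.+ + o → m ≡ n + o
+m≡+n++o⇒m≡n+o {n = n} {o} eq = +-injective (trans eq (sym (pos-+ n o)))

option⇒move : Option (L₂ b x₁ y₁ x₂ y₂) p q → Move b x₁ y₁ x₂ y₂ p q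
option⇒move {b = b} {p = p₁ , p₂} {q = _ , _} ((_ , _) , here refl , e₁ , e₂)
  with +-injective (trans e₁ (ℤ-+-identityʳ (+ p₁))) | +m≡+n-+o⇒m+o≡n {n = p₂} {b} e₂
... | refl | refl = drop _ _
option⇒move {x₁ = x₁} {y₁} {p = p₁ , p₂} {q = _ , _} ((_ , _) , there (here refl) , e₁ , e₂)
  with +m≡+n-+o⇒m+o≡n {n = p₁} {x₁} e₁ | +m≡+n++o⇒m≡n+o {n = p₂} {y₁} e₂
... | refl | refl = transfer₁ _ _
option⇒move {x₂ = x₂} {y₂} {p = p₁ , p₂} {q = _ , _} ((_ , _) , there (there (here refl)) , e₁ , e₂)
  with +m≡+n-+o⇒m+o≡n {n = p₁} {x₂} e₁ | +m≡+n++o⇒m≡n+o {n = p₂} {y₂} e₂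
... | refl | refl = transfer₂ _ _

move-descends : 0 < b → 0 < x₁ → 0 < x₂ → Move b x₁ y₁ x₂ y₂ p q → q <ₗₑₓ p
move-descends b>0 _    _    (drop _ q₂)      = inj₂ (refl , m<m+n q₂ b>0)
move-descends _   x₁>0 _    (transfer₁ q₁ _) = inj₁ (m<m+n q₁ x₁>0)
move-descends _   _    x₂>0 (transfer₂ q₁ _) = inj₁ (m<m+n q₁ x₂>0)

L₁⊆L₂ : L₁ b x₁ y₁ ⊆ L₂ b x₁ y₁ x₂ y₂
L₁⊆L₂ (here eq)         = here eq
L₁⊆L₂ (there (here eq)) = there (here eq)

drop-option : ∀ {p₁ p₂} → b ≤ p₂ → Option (L₁ b x₁ y₁) (p₁ , p₂) (p₁ , p₂ ∸ b)
drop-option {b = b} {p₁ = p₁} {p₂} b≤p₂ =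
  (+ 0 , ℤ.- + b) , here refl , sym (ℤ-+-identityʳ (+ p₁)) , sym (trans (m-n≡m⊖n p₂ b) (⊖-≥ b≤p₂))

transfer-option : ∀ {p₁ p₂} → x₁ ≤ p₁ → Option (L₁ b x₁ y₁) (p₁ , p₂) (p₁ ∸ x₁ , p₂ + y₁)
transfer-option {x₁ = x₁} {y₁ = y₁} {p₁ = p₁} {p₂} x₁≤p₁ =
  (ℤ.- + x₁ , + y₁) , there (here refl) , sym (trans (m-n≡m⊖n p₁ x₁) (⊖-≥ x₁≤p₁)) , pos-+ p₂ y₁

-- (−x₂, y₂) = k·(−x₁, y₁) + (c₁ − c₂)·(0, −b), a combination of an odd number of basic moves.
record OddCombination (b x₁ y₁ x₂ y₂ : ℕ) : Set where
  field
    k c₁ c₂           : ℕ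
    x₂≡k*x₁           : x₂ ≡ k * x₁
    y₂+c₁*b≡k*y₁+c₂*b : y₂ + c₁ * b ≡ k * y₁ + c₂ * b
    k+c₁+c₂-odd       : parity (k + c₁ + c₂) ≡ 1ℙ

self-combination : OddCombination b x₁ y₁ x₁ y₁
self-combination {x₁ = x₁} {y₁} = record
  { k = 1 ; c₁ = 0 ; c₂ = 0
  ; x₂≡k*x₁ = sym (*-identityˡ x₁)
  ; y₂+c₁*b≡k*y₁+c₂*b = cong (_+ 0) (sym (*-identityˡ y₁))
  ; k+c₁+c₂-odd = refl
  }

[m+kn]/n≡m/n+k : ∀ m k n .{{_ : NonZero n}} → (m + k * n) / n ≡ m / n + k
[m+kn]/n≡m/n+k m k n = trans (+-distrib-/-∣ʳ m (divides k refl)) (cong (_+_ (m / n)) (m*n/n≡m k n))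

module PlayLength (b x₁ y₁ : ℕ) .{{_ : NonZero b}} .{{_ : NonZero x₁}} where

  len : Pos → ℕ
  len (p₁ , p₂) = p₁ / x₁ + (p₂ + p₁ / x₁ * y₁) / b

  len-drop : ∀ p₁ p₂ c → len (p₁ , p₂ + c * b) ≡ len (p₁ , p₂) + c
  len-drop p₁ p₂ c = begin
    a + (p₂ + c * b + a * y₁) / b  ≡⟨ cong (λ n → a + n / b) (+-right-comm p₂ (c * b) (a * y₁)) ⟩
    a + (p₂ + a * y₁ + c * b) / b  ≡⟨ cong (_+_ a) ([m+kn]/n≡m/n+k (p₂ + a * y₁) c b) ⟩
    a + ((p₂ + a * y₁) / b + c)    ≡⟨ sym (+-assoc a _ c) ⟩
    len (p₁ , p₂) + c              ∎
    where a = p₁ / x₁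

  len-transfer : ∀ q₁ p₂ k → len (q₁ + k * x₁ , p₂) ≡ len (q₁ , p₂ + k * y₁) + k
  len-transfer q₁ p₂ k = begin
    (q₁ + k * x₁) / x₁ + (p₂ + (q₁ + k * x₁) / x₁ * y₁) / b
      ≡⟨ cong (λ a′ → a′ + (p₂ + a′ * y₁) / b) ([m+kn]/n≡m/n+k q₁ k x₁) ⟩
    a + k + (p₂ + (a + k) * y₁) / b    ≡⟨ cong (λ n → a + k + n / b) (distrib p₂ a k y₁) ⟩
    a + k + (p₂ + k * y₁ + a * y₁) / b ≡⟨ +-right-comm a k _ ⟩
    len (q₁ , p₂ + k * y₁) + k         ∎
    where
    a = q₁ / x₁
    open ℕ-Solver using (solve-∀)
    distrib : ∀ p a k y → p + (a + k) * y ≡ p + k * y + a * y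
    distrib = solve-∀

  len-terminal : ∀ {p₁ p₂} → p₁ < x₁ → p₂ < b → len (p₁ , p₂) ≡ 0
  len-terminal {p₁} {p₂} p₁<x₁ p₂<b = begin
    p₁ / x₁ + (p₂ + p₁ / x₁ * y₁) / b  ≡⟨ cong (λ a → a + (p₂ + a * y₁) / b) (m<n⇒m/n≡0 p₁<x₁) ⟩
    (p₂ + 0) / b                       ≡⟨ cong (_/ b) (+-identityʳ p₂) ⟩
    p₂ / b                             ≡⟨ m<n⇒m/n≡0 p₂<b ⟩
    0                                  ∎

  combination-flips : OddCombination b x₁ y₁ x₂ y₂ →
                      ∀ q₁ p₂ → parity (len (q₁ + x₂ , p₂)) ≡ parity (len (q₁ , p₂ + y₂)) ⁻¹
  combination-flips {x₂} {y₂} comb q₁ p₂ =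
    parity-flip {len (q₁ + x₂ , p₂)} {c₂} {len (q₁ , p₂ + y₂)} {k + c₁} (begin
    len (q₁ + x₂ , p₂) + c₂            ≡⟨ cong (λ u → len (q₁ + u , p₂) + c₂) x₂≡k*x₁ ⟩
    len (q₁ + k * x₁ , p₂) + c₂        ≡⟨ cong (_+ c₂) (len-transfer q₁ p₂ k) ⟩
    len (q₁ , p₂ + k * y₁) + k + c₂    ≡⟨ +-right-comm _ k c₂ ⟩
    len (q₁ , p₂ + k * y₁) + c₂ + k    ≡⟨ cong (_+ k) (sym (len-drop q₁ _ c₂)) ⟩
    len (q₁ , p₂ + k * y₁ + c₂ * b) + k ≡⟨ cong (λ v → len (q₁ , v) + k) (sym shifted) ⟩
    len (q₁ , p₂ + y₂ + c₁ * b) + k    ≡⟨ cong (_+ k) (len-drop q₁ (p₂ + y₂) c₁) ⟩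
    len (q₁ , p₂ + y₂) + c₁ + k        ≡⟨ +-assoc _ c₁ k ⟩
    len (q₁ , p₂ + y₂) + (c₁ + k)      ≡⟨ cong (_+_ (len (q₁ , p₂ + y₂))) (+-comm c₁ k) ⟩
    len (q₁ , p₂ + y₂) + (k + c₁)      ∎) k+c₁+c₂-odd
    where
    open OddCombination comb
    shifted : p₂ + y₂ + c₁ * b ≡ p₂ + k * y₁ + c₂ * b
    shifted = begin
      p₂ + y₂ + c₁ * b       ≡⟨ +-assoc p₂ y₂ _ ⟩
      p₂ + (y₂ + c₁ * b)     ≡⟨ cong (_+_ p₂) y₂+c₁*b≡k*y₁+c₂*b ⟩
      p₂ + (k * y₁ + c₂ * b) ≡⟨ sym (+-assoc p₂ _ _) ⟩
      p₂ + k * y₁ + c₂ * b   ∎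

  move-flips : OddCombination b x₁ y₁ x₂ y₂ → Move b x₁ y₁ x₂ y₂ p q →
               parity (len p) ≡ parity (len q) ⁻¹
  move-flips _ (drop p₁ q₂) =
    parity-flip {len (p₁ , q₂ + b)} {0} {len (p₁ , q₂)} {1} (begin
      len (p₁ , q₂ + b) + 0  ≡⟨ +-identityʳ _ ⟩
      len (p₁ , q₂ + b)      ≡⟨ cong (λ v → len (p₁ , q₂ + v)) (sym (*-identityˡ b)) ⟩
      len (p₁ , q₂ + 1 * b)  ≡⟨ len-drop p₁ q₂ 1 ⟩
      len (p₁ , q₂) + 1      ∎) refl
  move-flips _    (transfer₁ q₁ p₂) = combination-flips self-combination q₁ p₂
  move-flips comb (transfer₂ q₁ p₂) = combination-flips comb q₁ p₂

  nonterminal : ∀ p → len p ≢ 0 → Σ Pos (Option (L₁ b x₁ y₁) p)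
  nonterminal (p₁ , p₂) len≢0 with x₁ ≤? p₁ | b ≤? p₂
  ... | yes x₁≤p₁ | _        = _ , transfer-option x₁≤p₁
  ... | no _      | yes b≤p₂ = _ , drop-option b≤p₂
  ... | no x₁≰p₁  | no b≰p₂  = ⊥-elim (len≢0 (len-terminal (≰⇒> x₁≰p₁) (≰⇒> b≰p₂)))

  odd-nonterminal : ∀ p → parity (len p) ≡ 1ℙ → Σ Pos (Option (L₁ b x₁ y₁) p)
  odd-nonterminal p odd = nonterminal p (λ len≡0 → p≢p⁻¹ 0ℙ (trans (sym (cong parity len≡0)) odd))

  sg : Pos → ℕ
  sg = toℕ ∘ parity ∘ len

  L₂-isSG : OddCombination b x₁ y₁ x₂ y₂ → IsSG (L₂ b x₁ y₁ x₂ y₂) sg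
  L₂-isSG comb = isSG-toℕ (parity ∘ len) (move-flips comb ∘ option⇒move)
                          (λ p → map₂ (Option-mono L₁⊆L₂) ∘ odd-nonterminal p)

  -- L(b;x₁,y₁) is a subgame of L(b;x₁,y₁;x₁,y₁), whose second transfer is trivially an
  -- odd combination.
  L₁-isSG : IsSG (L₁ b x₁ y₁) sg
  L₁-isSG = isSG-toℕ (parity ∘ len) (move-flips self-combination ∘ option⇒move ∘ Option-mono L₁⊆L₂)
                     odd-nonterminal

TransferCongruence : ℕ → ℕ → ℕ → ℕ → ℕ → Set
TransferCongruence b x₁ y₁ x₂ y₂ =
  (Σ ℤ λ k → OddZ k × (+ x₂ ≡ k ℤ.* + x₁) × CongMod (+ (2 * b)) (+ y₂) (k ℤ.* + y₁))
  ⊎ (Σ ℤ λ k → EvenZ k × (+ x₂ ≡ k ℤ.* + x₁) × CongMod (+ (2 * b)) (+ y₂) (k ℤ.* + y₁ ℤ.+ + b))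

∣m⊖n∣≡d⇒m≡n+d⊎m+d≡n : ∀ m n {d} → ℤ.∣ m ⊖ n ∣ ≡ d → m ≡ n + d ⊎ m + d ≡ n
∣m⊖n∣≡d⇒m≡n+d⊎m+d≡n m n eq with ≤-total n m
... | inj₁ n≤m =
  inj₁ (trans (sym (m+[n∸m]≡n n≤m)) (cong (_+_ n) (trans (cong ℤ.∣_∣ (sym (⊖-≥ n≤m))) eq)))
... | inj₂ m≤n =
  inj₂ (trans (cong (_+_ m) (trans (sym eq) (∣⊖∣-≤ m≤n))) (m+[n∸m]≡n m≤n))

∣+m-i∣≡d⇒∣m⊖n∣≡d : ∀ {m n i d} → + n ≡ i → ℤ.∣ + m ℤ.- i ∣ ≡ d → ℤ.∣ m ⊖ n ∣ ≡ d
∣+m-i∣≡d⇒∣m⊖n∣≡d {m} {n} refl eq = trans (cong ℤ.∣_∣ (sym (m-n≡m⊖n m n))) eq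

combination-from-distance : ∀ k r m → x₂ ≡ k * x₁ → ℤ.∣ y₂ ⊖ (r * b + k * y₁) ∣ ≡ m * (2 * b) →
                            parity (r + k) ≡ 1ℙ → OddCombination b x₁ y₁ x₂ y₂
combination-from-distance {y₂ = y₂} {b = b} {y₁ = y₁} k r m x₂≡k*x₁ dist r+k-odd
  with ∣m⊖n∣≡d⇒m≡n+d⊎m+d≡n y₂ (r * b + k * y₁) dist
... | inj₁ y₂≡ = record
  { k = k ; c₁ = 0 ; c₂ = r + 2 * m ; x₂≡k*x₁ = x₂≡k*x₁
  ; y₂+c₁*b≡k*y₁+c₂*b = trans (+-identityʳ y₂) (trans y₂≡ (regroup r b k y₁ m))
  ; k+c₁+c₂-odd = trans (cong parity (reorder₁ k r m)) (trans (parity-+-2* (r + k) m) r+k-odd)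
  }
  where
  open ℕ-Solver using (solve-∀)
  regroup : ∀ r b k y m → r * b + k * y + m * (2 * b) ≡ k * y + (r + 2 * m) * b
  regroup = solve-∀
  reorder₁ : ∀ k r m → k + 0 + (r + 2 * m) ≡ r + k + 2 * m
  reorder₁ = solve-∀
... | inj₂ y₂+d≡ = record
  { k = k ; c₁ = 2 * m ; c₂ = r ; x₂≡k*x₁ = x₂≡k*x₁
  ; y₂+c₁*b≡k*y₁+c₂*b = trans (cong (_+_ y₂) (swap m b)) (trans y₂+d≡ (+-comm (r * b) (k * y₁)))
  ; k+c₁+c₂-odd = trans (cong parity (reorder₂ k r m)) (trans (parity-+-2* (r + k) m) r+k-odd)
  }
  where
  open ℕ-Solver using (solve-∀)
  swap : ∀ m b → 2 * m * b ≡ m * (2 * b)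
  swap = solve-∀
  reorder₂ : ∀ k r m → k + 2 * m + r ≡ r + k + 2 * m
  reorder₂ = solve-∀

odd⇒parity≡1ℙ : ∀ {k} → OddZ (+ k) → parity k ≡ 1ℙ
odd⇒parity≡1ℙ {k} (+ j , eq) =
  trans (cong parity k≡2j+1) (trans (+-homo-+ (2 * j) 1) (cong (ℙ._+ 1ℙ) (*-homo-* 2 j)))
  where
  k≡2j+1 : k ≡ 2 * j + 1
  k≡2j+1 =
    +-injective (trans eq (trans (cong (ℤ._+ + 1) (sym (pos-* 2 j))) (sym (pos-+ (2 * j) 1))))
odd⇒parity≡1ℙ (-[1+ zero ] , ())
odd⇒parity≡1ℙ (-[1+ suc _ ] , ())

even⇒parity≡0ℙ : ∀ {k} → EvenZ (+ k) → parity k ≡ 0ℙ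
even⇒parity≡0ℙ (+ j , eq) =
  trans (cong parity (+-injective (trans eq (sym (pos-* 2 j))))) (*-homo-* 2 j)
even⇒parity≡0ℙ (-[1+ _ ] , ())

oddCombination : 0 < x₁ → TransferCongruence b x₁ y₁ x₂ y₂ → OddCombination b x₁ y₁ x₂ y₂
oddCombination {x₁ = suc _} _ (inj₁ (-[1+ _ ] , _ , () , _))
oddCombination {x₁ = suc _} _ (inj₂ (-[1+ _ ] , _ , () , _))
oddCombination {x₁ = x₁} {y₁ = y₁} _ (inj₁ (+ k , k-odd , x₂≡ , divides m dist)) =
  combination-from-distance k 0 m (+-injective (trans x₂≡ (sym (pos-* k x₁))))
    (∣+m-i∣≡d⇒∣m⊖n∣≡d (pos-* k y₁) dist) (odd⇒parity≡1ℙ k-odd)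
oddCombination {x₁ = x₁} {b = b} {y₁ = y₁} _ (inj₂ (+ k , k-even , x₂≡ , divides m dist)) =
  combination-from-distance k 1 m (+-injective (trans x₂≡ (sym (pos-* k x₁))))
    (∣+m-i∣≡d⇒∣m⊖n∣≡d shift dist) (trans (+-homo-+ 1 k) (cong _⁻¹ (even⇒parity≡0ℙ k-even)))
  where
  shift : + (1 * b + k * y₁) ≡ + k ℤ.* + y₁ ℤ.+ + b
  shift = begin
    + (1 * b + k * y₁)      ≡⟨ cong (λ n → + (n + k * y₁)) (*-identityˡ b) ⟩
    + (b + k * y₁)          ≡⟨ cong +_ (+-comm b (k * y₁)) ⟩
    + (k * y₁ + b)          ≡⟨ pos-+ (k * y₁) b ⟩
    + (k * y₁) ℤ.+ + b      ≡⟨ cong (ℤ._+ + b) (pos-* k y₁) ⟩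
    + k ℤ.* + y₁ ℤ.+ + b    ∎

≤1⇒≢ : ∀ {n m} → n ≤ 1 → 1 < m → n ≢ m
≤1⇒≢ n≤1 1<m refl = <⇒≱ 1<m n≤1

mainTheorem19 : (b x₁ y₁ x₂ y₂ : ℕ) → 0 < b → 0 < x₁ → 0 < x₂ →
    (Σ ℤ λ k → OddZ k × (+ x₂ ≡ k ℤ.* + x₁) × CongMod (+ (2 Data.Nat.* b)) (+ y₂) (k ℤ.* + y₁))
    ⊎ (Σ ℤ λ k → EvenZ k × (+ x₂ ≡ k ℤ.* + x₁) × CongMod (+ (2 Data.Nat.* b)) (+ y₂) (k ℤ.* + y₁ ℤ.+ + b)) →
    (Σ (Pos → ℕ) λ g → IsSG (L₂ b x₁ y₁ x₂ y₂) g) ×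
    ((g h : Pos → ℕ) → IsSG (L₂ b x₁ y₁ x₂ y₂) g → IsSG (L₁ b x₁ y₁) h → (p : Pos) → g p ≡ h p) ×
    ((g : Pos → ℕ) → IsSG (L₂ b x₁ y₁ x₂ y₂) g → (p : Pos) → (g p ≢ 2) × (g p ≢ 3))
mainTheorem19 b x₁ y₁ x₂ y₂ b>0 x₁>0 x₂>0 congruence =
    (sg , sg-isSG) ,
    (λ g h g-sg h-sg p → trans (unique₂ g-sg sg-isSG p) (unique₁ L₁-isSG h-sg p)) ,
    (λ g g-sg p → ≤1⇒≢ (values≤1 g-sg p) (s≤s (s≤s z≤n)) , ≤1⇒≢ (values≤1 g-sg p) (s≤s (s≤s z≤n)))
  where
  open PlayLength b x₁ y₁ {{>-nonZero b>0}} {{>-nonZero x₁>0}}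

  sg-isSG : IsSG (L₂ b x₁ y₁ x₂ y₂) sg
  sg-isSG = L₂-isSG (oddCombination x₁>0 congruence)

  unique₂ : ∀ {g h} → IsSG (L₂ b x₁ y₁ x₂ y₂) g → IsSG (L₂ b x₁ y₁ x₂ y₂) h → ∀ p → g p ≡ h p
  unique₂ = isSG-unique <ₗₑₓ-wellFounded (move-descends b>0 x₁>0 x₂>0 ∘ option⇒move)

  unique₁ : ∀ {g h} → IsSG (L₁ b x₁ y₁) g → IsSG (L₁ b x₁ y₁) h → ∀ p → g p ≡ h p
  unique₁ = isSG-unique <ₗₑₓ-wellFounded
              (move-descends b>0 x₁>0 x₁>0 ∘ option⇒move {x₂ = x₁} {y₂ = y₁} ∘ Option-mono L₁⊆L₂)

  values≤1 : ∀ {g} → IsSG (L₂ b x₁ y₁ x₂ y₂) g → ∀ p → g p ≤ 1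
  values≤1 g-sg p = subst (_≤ 1) (unique₂ sg-isSG g-sg p) (toℕ≤1 _)
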